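{- Let $g \geq 3$ and let $\Gamma_g$ be a Hamiltonian $3$-regular graph of girth $g$. Let $e = uv$ be an edge of $\Gamma_g$ such that at least one cycle of length $g$ in $\Gamma_g$ does not traverse $e$. Take three disjoint copies of $\Gamma_g$, with $u_iv_i$ the copy of $e$ in the $i$-th copy ($i=1,2,3$). Form the graph $\Gamma_{g,2}^*$ by deleting the edges $u_1v_1$, $u_2v_2$, $u_3v_3$, adding two new vertices $x, y$, and adding the edges $u_1x, u_2x, u_3x, v_1y, v_2y, v_3y$. Then $\Gamma_{g,2}^*$ (which is $3$-regular) has girth $g$.
   Context: The girth of a graph is the length of its shortest cycle. A graph is Hamiltonian if it has a simple cycle through all its vertices. -}

module Defs where

open import Level using (0ℓ)
open import Data.Nat using (ℕ; zero; suc; _≤_)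
open import Data.Fin using (Fin; inject₁; fromℕ)
open import Data.Bool using (Bool; true; false)
open import Data.Product using (Σ; ∃; _×_; _,_; proj₁; proj₂)
open import Data.Sum using (_⊎_; inj₁; inj₂)
open import Data.Empty using (⊥)
open import Relation.Nullary using (¬_)
open import Relation.Binary.PropositionalEquality using (_≡_; refl; sym)
open import Function.Definitions using (Injective; Surjective)

record SimpleGraph (V : Set) : Set₁ where
  field
    Adj    : V → V → Set
    symm   : ∀ {a b} → Adj a b → Adj b a
    irrefl : ∀ {a} → ¬ Adj a a
open SimpleGraph public

record Cycle {V : Set} (G : SimpleGraph V) : Set where
  field
    m       : ℕ
    long    : 3 ≤ suc m
    vert    : Fin (suc m) → V
    inj     : Injective _≡_ _≡_ vert
    step    : (i : Fin m) → Adj G (vert (inject₁ i)) (vert (Fin.suc i))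
    close   : Adj G (vert (fromℕ m)) (vert Fin.zero)
open Cycle public

cycleLength : ∀ {V} {G : SimpleGraph V} → Cycle G → ℕ
cycleLength C = suc (m C)

SameEdge : ∀ {V : Set} → V → V → V → V → Set
SameEdge a b u v = (a ≡ u × b ≡ v) ⊎ (a ≡ v × b ≡ u)

Traverses : ∀ {V} {G : SimpleGraph V} → Cycle G → V → V → Set
Traverses C u v =
  (∃ λ (i : Fin (m C)) → SameEdge (vert C (inject₁ i)) (vert C (Fin.suc i)) u v)
  ⊎ SameEdge (vert C (fromℕ (m C))) (vert C Fin.zero) u v

HasGirth : ∀ {V} → SimpleGraph V → ℕ → Set
HasGirth G g = (∃ λ (C : Cycle G) → cycleLength C ≡ g)
             × (∀ (C : Cycle G) → g ≤ cycleLength C)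

Hamiltonian : ∀ {V} → SimpleGraph V → Set
Hamiltonian G = ∃ λ (C : Cycle G) → Surjective _≡_ _≡_ (vert C)

Degree3 : ∀ {V} → SimpleGraph V → V → Set
Degree3 {V} G a = Σ V λ p → Σ V λ q → Σ V λ r →
  (Adj G a p × Adj G a q × Adj G a r)
  × (¬ p ≡ q × ¬ p ≡ r × ¬ q ≡ r)
  × (∀ w → Adj G a w → w ≡ p ⊎ w ≡ q ⊎ w ≡ r)

Cubic : ∀ {V} → SimpleGraph V → Set
Cubic {V} G = ∀ (a : V) → Degree3 G a

-- The construction Γ*_{g,2}.
-- Vertices: (i , a) = vertex a in copy i (i ∈ Fin 3), plus
-- inj₂ false = x and inj₂ true = y.

StarV : ℕ → Set
StarV n = (Fin 3 × Fin n) ⊎ Bool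

module _ {n : ℕ} (G : SimpleGraph (Fin n)) (u v : Fin n) where

  StarAdj : StarV n → StarV n → Set
  StarAdj (inj₁ (i , a)) (inj₁ (j , b)) = i ≡ j × Adj G a b × ¬ SameEdge a b u v
  StarAdj (inj₁ (i , a)) (inj₂ false) = a ≡ u
  StarAdj (inj₁ (i , a)) (inj₂ true)  = a ≡ v
  StarAdj (inj₂ false) (inj₁ (j , b)) = b ≡ u
  StarAdj (inj₂ true)  (inj₁ (j , b)) = b ≡ v
  StarAdj (inj₂ false) (inj₂ _) = ⊥
  StarAdj (inj₂ true) (inj₂ _) = ⊥

  private
    swapE : ∀ {a b} → SameEdge b a u v → SameEdge a b u v
    swapE (inj₁ (p , q)) = inj₂ (q , p)
    swapE (inj₂ (p , q)) = inj₁ (q , p)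

    starSym : ∀ {s t} → StarAdj s t → StarAdj t s
    starSym {inj₁ _} {inj₁ _} (e , h , ne) = sym e , symm G h , λ s → ne (swapE s)
    starSym {inj₁ _} {inj₂ false} p = p
    starSym {inj₁ _} {inj₂ true} p = p
    starSym {inj₂ false} {inj₁ _} p = p
    starSym {inj₂ true} {inj₁ _} p = p
    starSym {inj₂ false} {inj₂ _} ()
    starSym {inj₂ true} {inj₂ _} ()

    starIrr : ∀ {s} → ¬ StarAdj s s
    starIrr {inj₁ _} (_ , h , _) = irrefl G h
    starIrr {inj₂ false} ()
    starIrr {inj₂ true} ()

  Star : SimpleGraph (StarV n)
  Star = record { Adj = StarAdj ; symm = λ {s} {t} → starSym {s} {t} ; irrefl = λ {s} → starIrr {s} }

module Submission where

-- Cubicity is local: away from the hubs x, y a vertex (i , a) sees the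
-- injective image of its neighbourhood in Γ_g, with the neighbour across the
-- deleted edge uv replaced by a hub; the hubs see the three copies of u
-- (resp. v).
--
-- Girth g: a girth cycle avoiding uv sits inside copy 0, so girth ≤ g.  For
-- girth ≥ g we read a cycle C of Γ*_{g,2} as an L-periodic walk of the graph
-- (`CycleWalk`, using residues mod L).  If C never meets a hub, C stays in one
-- copy and projects to a cycle of Γ_g of length L.  Otherwise, right after a
-- hub b the walk enters some copy i at end b and leaves it (necessarily into a
-- hub b' ≠ b, as C is a cycle of length ≥ 3) after k steps, at end b'.  The
-- projected segment is a path of Γ_g from end b to end b' avoiding the edge uv
-- (so k ≥ 2), and uv closes it into a cycle of Γ_g of length k + 1 ≤ L
-- (`path-cycle`).  In every case the girth of Γ_g bounds L from below.

open import Defs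
open import Data.Nat using (ℕ; zero; suc; _+_; _∸_; _≤_; _<_; z≤n; s≤s; s≤s⁻¹; NonZero)
open import Data.Nat.Properties
open import Data.Nat.DivMod using (_%_; _mod_; m%n<n; %-distribˡ-+; m%n%n≡m%n; m<n⇒m%n≡m; m≤n⇒[n∸m]%m≡n%m; [m+n]%n≡m%n; n%n≡0)
open import Data.Fin as Fin using (Fin; toℕ; fromℕ<; inject₁; fromℕ)
open import Data.Fin.Properties using (toℕ-injective; toℕ-fromℕ<; toℕ-inject₁; toℕ-fromℕ; toℕ<n; toℕ≤pred[n])
open import Data.Bool using (Bool; true; false; not)
open import Data.Bool.Properties using (¬-not) renaming (_≟_ to _≟ᵇ_)
open import Data.Product using (Σ; ∃; _×_; _,_; proj₁; proj₂)
open import Data.Sum as Sum using (_⊎_; inj₁; inj₂)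
open import Data.Empty using (⊥-elim)
open import Function using (_∘_)
open import Function.Definitions using (Injective)
open import Relation.Binary.Definitions using (tri<; tri≈; tri>)
open import Relation.Nullary using (¬_; yes; no)
open import Relation.Binary.PropositionalEquality

IsWalk : ∀ {V} → SimpleGraph V → (ℕ → V) → Set
IsWalk G w = ∀ j → Adj G (w j) (w (suc j))

-- Residues modulo L.  We need that shifting by 0 < d < L changes the residue,
-- so that a window of L consecutive positions sees L distinct residues.
module Residues (L : ℕ) .{{_ : NonZero L}} where

  %-shift : ∀ d i → (d + i) % L ≡ (d + i % L) % L
  %-shift d i = begin
    (d + i) % L              ≡⟨ %-distribˡ-+ d i L ⟩
    (d % L + i % L) % L      ≡⟨ cong (λ z → (d % L + z) % L) (sym (m%n%n≡m%n i L)) ⟩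
    (d % L + i % L % L) % L  ≡⟨ %-distribˡ-+ d (i % L) L ⟨
    (d + i % L) % L          ∎
    where open ≡-Reasoning

  -- a residue r < L moved by 0 < d < L lands either in (r , L) or in [0 , r)
  residue-moves : ∀ d r → 0 < d → d < L → r < L → (d + r) % L ≢ r
  residue-moves d r 0<d d<L r<L eq with d + r <? L
  ... | yes d+r<L = <⇒≢ (m<n+m r 0<d) (trans (sym eq) (m<n⇒m%n≡m d+r<L))
  ... | no d+r≮L = <⇒≢ wrapped<r (trans (sym (m<n⇒m%n≡m wrapped<L)) (trans reduce eq))
    where
      L≤d+r : L ≤ d + r
      L≤d+r = ≮⇒≥ d+r≮L
      wrapped<r : d + r ∸ L < r
      wrapped<r = subst (d + r ∸ L <_) (m+n∸m≡n L r) (∸-monoˡ-< (+-monoˡ-< r d<L) L≤d+r)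
      wrapped<L : d + r ∸ L < L
      wrapped<L = <-trans wrapped<r r<L
      reduce : (d + r ∸ L) % L ≡ (d + r) % L
      reduce = m≤n⇒[n∸m]%m≡n%m L≤d+r

  shift-≢ : ∀ d i → 0 < d → d < L → (d + i) % L ≢ i % L
  shift-≢ d i 0<d d<L eq = residue-moves d (i % L) 0<d d<L (m%n<n i L) (trans (sym (%-shift d i)) eq)

  shifts-apart : ∀ a {x y} → x < y → y < L → (x + a) % L ≢ (y + a) % L
  shifts-apart a {x} {y} x<y y<L eq =
    shift-≢ (y ∸ x) (x + a) (m<n⇒0<n∸m x<y) (≤-<-trans (m∸n≤m y x) y<L) (trans (cong (_% L) regroup) (sym eq))
    where
      regroup : y ∸ x + (x + a) ≡ y + a
      regroup = trans (sym (+-assoc (y ∸ x) x a)) (cong (_+ a) (m∸n+n≡m (<⇒≤ x<y)))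

  window-injective : ∀ a {x y} → x < L → y < L → (x + a) % L ≡ (y + a) % L → x ≡ y
  window-injective a {x} {y} x<L y<L eq with <-cmp x y
  ... | tri< x<y _ _ = ⊥-elim (shifts-apart a x<y y<L eq)
  ... | tri≈ _ x≡y _ = x≡y
  ... | tri> _ _ y<x = ⊥-elim (shifts-apart a y<x x<L (sym eq))

module CycleWalk {V : Set} {G : SimpleGraph V} (C : Cycle G) where
  L : ℕ
  L = cycleLength C

  open Residues L

  walk : ℕ → V
  walk j = vert C (j mod L)

  walk-at : ∀ j (x : Fin L) → j % L ≡ toℕ x → walk j ≡ vert C x
  walk-at j x eq = cong (vert C) (toℕ-injective (trans (toℕ-fromℕ< (m%n<n j L)) eq))

  walk-adj : IsWalk G walk
  walk-adj j with m≤n⇒m<n∨m≡n (s≤s⁻¹ (m%n<n j L))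
  ... | inj₁ r<M =
    subst₂ (Adj G) (sym (walk-at j (inject₁ i) here)) (sym (walk-at (suc j) (Fin.suc i) next)) (step C i)
    where
      i : Fin (m C)
      i = fromℕ< r<M
      here : j % L ≡ toℕ (inject₁ i)
      here = sym (trans (toℕ-inject₁ i) (toℕ-fromℕ< r<M))
      next : suc j % L ≡ suc (toℕ i)
      next = trans (%-shift 1 j) (trans (m<n⇒m%n≡m (s≤s r<M)) (cong suc (sym (toℕ-fromℕ< r<M))))
  ... | inj₂ r≡M =
    subst₂ (Adj G) (sym (walk-at j (fromℕ (m C)) here)) (sym (walk-at (suc j) Fin.zero next)) (close C)
    where
      here : j % L ≡ toℕ (fromℕ (m C))
      here = trans r≡M (sym (toℕ-fromℕ (m C)))
      next : suc j % L ≡ 0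
      next = trans (%-shift 1 j) (trans (cong (λ r → suc r % L) r≡M) (n%n≡0 L))

  walk-periodic : ∀ a → walk (L + a) ≡ walk a
  walk-periodic a = walk-at (L + a) (a mod L)
    (trans (cong (_% L) (+-comm L a)) (trans ([m+n]%n≡m%n a L) (sym (toℕ-fromℕ< (m%n<n a L)))))

  walk-window-injective : ∀ a {x y} → x < L → y < L → walk (x + a) ≡ walk (y + a) → x ≡ y
  walk-window-injective a {x} {y} x<L y<L eq = window-injective a x<L y<L
    (trans (sym (toℕ-fromℕ< (m%n<n (x + a) L))) (trans (cong toℕ (inj C eq)) (toℕ-fromℕ< (m%n<n (y + a) L))))

path-cycle : ∀ {V} {G : SimpleGraph V} (p : ℕ → V) (k : ℕ) → 2 ≤ k
  → (∀ j → j < k → Adj G (p j) (p (suc j)))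
  → (∀ {x y} → x ≤ k → y ≤ k → p x ≡ p y → x ≡ y)
  → Adj G (p k) (p 0)
  → Σ (Cycle G) λ D → cycleLength D ≡ suc k
path-cycle {G = G} p k 2≤k steps distinct closing =
  record { m = k ; long = s≤s 2≤k ; vert = p ∘ toℕ ; inj = injective ; step = step′ ; close = close′ } , refl
  where
    injective : Injective _≡_ _≡_ (p ∘ toℕ)
    injective {x} {y} eq = toℕ-injective (distinct (toℕ≤pred[n] x) (toℕ≤pred[n] y) eq)
    step′ : (i : Fin k) → Adj G (p (toℕ (inject₁ i))) (p (suc (toℕ i)))
    step′ i = subst (λ z → Adj G (p z) (p (suc (toℕ i)))) (sym (toℕ-inject₁ i)) (steps (toℕ i) (toℕ<n i))
    close′ : Adj G (p (toℕ (fromℕ k))) (p 0)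
    close′ = subst (λ z → Adj G (p z) (p 0)) (sym (toℕ-fromℕ k)) closing

degree3-transfer : ∀ {V W} {G : SimpleGraph V} {H : SimpleGraph W} {a : V} {s : W} (φ : V → W)
  → Injective _≡_ _≡_ φ
  → (∀ y → Adj G a y → Adj H s (φ y))
  → (∀ w → Adj H s w → ∃ λ y → Adj G a y × w ≡ φ y)
  → Degree3 G a → Degree3 H s
degree3-transfer {H = H} {s = s} φ φ-inj forth back (p , q , r , (ap , aq , ar) , (p≢q , p≢r , q≢r) , only) =
  φ p , φ q , φ r , (forth p ap , forth q aq , forth r ar) , (p≢q ∘ φ-inj , p≢r ∘ φ-inj , q≢r ∘ φ-inj) , covered
  where
    covered : ∀ w → Adj H s w → w ≡ φ p ⊎ w ≡ φ q ⊎ w ≡ φ r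
    covered w sw with back w sw
    ... | y , ay , refl = Sum.map (cong φ) (Sum.map (cong φ) (cong φ)) (only y ay)

lift-cycle : ∀ {n} (G : SimpleGraph (Fin n)) u v (C : Cycle G) → ¬ Traverses C u v
  → Σ (Cycle (Star G u v)) λ D → cycleLength D ≡ cycleLength C
lift-cycle {n} G u v C avoids =
  record { m = m C ; long = long C ; vert = λ j → inj₁ (Fin.zero , vert C j)
         ; inj = λ eq → inj C (cong copy-vertex eq)
         ; step = λ i → refl , step C i , (λ same → avoids (inj₁ (i , same)))
         ; close = refl , close C , (λ same → avoids (inj₂ same)) } , refl
  where
    copy-vertex : StarV n → Fin n
    copy-vertex (inj₁ (_ , c)) = c
    copy-vertex (inj₂ _) = u

module StarGraph {n} (G : SimpleGraph (Fin n)) (u v : Fin n) (uv : Adj G u v) where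
  S : SimpleGraph (StarV n)
  S = Star G u v

  u≢v : u ≢ v
  u≢v refl = irrefl G uv

  -- hub b (x = false, y = true) is joined to the vertex end b of every copy
  end : Bool → Fin n
  end false = u
  end true = v

  end-injective : ∀ {b b'} → end b ≡ end b' → b ≡ b'
  end-injective {false} {false} _ = refl
  end-injective {false} {true} u≡v = ⊥-elim (u≢v u≡v)
  end-injective {true} {false} v≡u = ⊥-elim (u≢v (sym v≡u))
  end-injective {true} {true} _ = refl

  ends-adj : ∀ b → Adj G (end b) (end (not b))
  ends-adj false = uv
  ends-adj true = symm G uv

  ends-edge : ∀ b → SameEdge (end b) (end (not b)) u v
  ends-edge false = inj₁ (refl , refl)
  ends-edge true = inj₂ (refl , refl)

  partner : ∀ b {y} → SameEdge (end b) y u v → y ≡ end (not b)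
  partner false (inj₁ (_ , y≡v)) = y≡v
  partner false (inj₂ (u≡v , _)) = ⊥-elim (u≢v u≡v)
  partner true (inj₁ (v≡u , _)) = ⊥-elim (u≢v (sym v≡u))
  partner true (inj₂ (_ , y≡u)) = y≡u

  hub-link : ∀ i b → Adj S (inj₁ (i , end b)) (inj₂ b)
  hub-link i false = refl
  hub-link i true = refl

  hub-adj : ∀ {i c} b → Adj S (inj₁ (i , c)) (inj₂ b) → c ≡ end b
  hub-adj false c≡u = c≡u
  hub-adj true c≡v = c≡v

  hub-neighbour : ∀ b s → Adj S (inj₂ b) s → ∃ λ i → s ≡ inj₁ (i , end b)
  hub-neighbour false (inj₁ (i , _)) refl = i , refl
  hub-neighbour true (inj₁ (i , _)) refl = i , refl

  into : Fin 3 → Fin n → StarV n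
  into i y = inj₁ (i , y)

  into-injective : ∀ i → Injective _≡_ _≡_ (into i)
  into-injective i refl = refl

  hub-degree3 : ∀ b → Degree3 S (inj₂ b)
  hub-degree3 b =
    into c₀ (end b) , into c₁ (end b) , into c₂ (end b) ,
    (link c₀ , link c₁ , link c₂) , ((λ ()) , (λ ()) , (λ ())) , covered
    where
      c₀ c₁ c₂ : Fin 3
      c₀ = Fin.zero
      c₁ = Fin.suc Fin.zero
      c₂ = Fin.suc (Fin.suc Fin.zero)
      link : ∀ i → Adj S (inj₂ b) (into i (end b))
      link i = symm S (hub-link i b)
      covered : ∀ w → Adj S (inj₂ b) w → w ≡ into c₀ (end b) ⊎ w ≡ into c₁ (end b) ⊎ w ≡ into c₂ (end b)
      covered w bw with hub-neighbour b w bw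
      ... | Fin.zero , refl = inj₁ refl
      ... | Fin.suc Fin.zero , refl = inj₂ (inj₁ refl)
      ... | Fin.suc (Fin.suc Fin.zero) , refl = inj₂ (inj₂ refl)

  interior-degree3 : ∀ i a → a ≢ u → a ≢ v → Degree3 G a → Degree3 S (inj₁ (i , a))
  interior-degree3 i a a≢u a≢v = degree3-transfer {G = G} {H = S} (into i) (into-injective i) forth back
    where
      off-edge : ∀ {y} → ¬ SameEdge a y u v
      off-edge (inj₁ (a≡u , _)) = a≢u a≡u
      off-edge (inj₂ (a≡v , _)) = a≢v a≡v
      forth : ∀ y → Adj G a y → Adj S (inj₁ (i , a)) (into i y)
      forth y ay = refl , ay , off-edge
      back : ∀ w → Adj S (inj₁ (i , a)) w → ∃ λ y → Adj G a y × w ≡ into i y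
      back (inj₁ (_ , y)) (refl , ay , _) = y , ay , refl
      back (inj₂ false) a≡u = ⊥-elim (a≢u a≡u)
      back (inj₂ true) a≡v = ⊥-elim (a≢v a≡v)

  -- end b of copy i keeps its neighbourhood, except that end (not b) is
  -- replaced by the hub b
  endpoint-degree3 : ∀ i b → Degree3 G (end b) → Degree3 S (inj₁ (i , end b))
  endpoint-degree3 i b = degree3-transfer {G = G} {H = S} redirect redirect-injective forth back
    where
      redirect : Fin n → StarV n
      redirect y with y Fin.≟ end (not b)
      ... | yes _ = inj₂ b
      ... | no _ = into i y
      redirect-partner : redirect (end (not b)) ≡ inj₂ b
      redirect-partner with end (not b) Fin.≟ end (not b)
      ... | yes _ = refl
      ... | no ne = ⊥-elim (ne refl)
      redirect-other : ∀ {y} → y ≢ end (not b) → redirect y ≡ into i y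
      redirect-other {y} ne with y Fin.≟ end (not b)
      ... | yes eq = ⊥-elim (ne eq)
      ... | no _ = refl
      redirect-injective : Injective _≡_ _≡_ redirect
      redirect-injective {y} {y'} eq with y Fin.≟ end (not b) | y' Fin.≟ end (not b)
      redirect-injective refl | yes refl | yes refl = refl
      redirect-injective () | yes _ | no _
      redirect-injective () | no _ | yes _
      redirect-injective refl | no _ | no _ = refl
      forth : ∀ y → Adj G (end b) y → Adj S (inj₁ (i , end b)) (redirect y)
      forth y ay with y Fin.≟ end (not b)
      ... | yes refl = hub-link i b
      ... | no ne = refl , ay , ne ∘ partner b
      back : ∀ w → Adj S (inj₁ (i , end b)) w → ∃ λ y → Adj G (end b) y × w ≡ redirect y
      back (inj₁ (_ , y)) (refl , ay , off) with y Fin.≟ end (not b)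
      ... | yes refl = ⊥-elim (off (ends-edge b))
      ... | no ne = y , ay , sym (redirect-other ne)
      back (inj₂ b') bw with end-injective (hub-adj b' bw)
      ... | refl = end (not b) , ends-adj b , sym redirect-partner

  cubic : Cubic G → Cubic S
  cubic cubicG (inj₂ b) = hub-degree3 b
  cubic cubicG (inj₁ (i , a)) with a Fin.≟ u | a Fin.≟ v
  ... | yes refl | _ = endpoint-degree3 i false (cubicG u)
  ... | no _ | yes refl = endpoint-degree3 i true (cubicG v)
  ... | no a≢u | no a≢v = interior-degree3 i a a≢u a≢v (cubicG a)

  InCopy : Fin 3 → StarV n → Set
  InCopy i s = ∃ λ c → s ≡ inj₁ (i , c)

  hub-not-in-copy : ∀ {i b} → ¬ InCopy i (inj₂ b)
  hub-not-in-copy (_ , ())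

  StaysIn : Fin 3 → (ℕ → StarV n) → ℕ → Set
  StaysIn i w k = ∀ j → j ≤ k → InCopy i (w j)

  copy-step : ∀ {i c} s → Adj S (inj₁ (i , c)) s → InCopy i s ⊎ ∃ λ b → s ≡ inj₂ b
  copy-step (inj₁ (_ , c')) (refl , _ , _) = inj₁ (c' , refl)
  copy-step (inj₂ b) _ = inj₂ (b , refl)

  leave-copy : ∀ {i} (w : ℕ → StarV n) → IsWalk S w → InCopy i (w 0) → ∀ r →
    StaysIn i w r ⊎ (∃ λ k → k < r × StaysIn i w k × ∃ λ b → w (suc k) ≡ inj₂ b)
  leave-copy w walk start zero = inj₁ λ { .zero z≤n → start }
  leave-copy {i} w walk start (suc r) with leave-copy w walk start r
  ... | inj₂ (k , k<r , stay , exit) = inj₂ (k , m<n⇒m<1+n k<r , stay , exit)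
  ... | inj₁ stay with stay r ≤-refl
  ...   | c , at-r with copy-step (w (suc r)) (subst (λ s → Adj S s (w (suc r))) at-r (walk r))
  ...     | inj₂ exit = inj₂ (r , n<1+n r , stay , exit)
  ...     | inj₁ inside = inj₁ extended
    where
      extended : StaysIn i w (suc r)
      extended j j≤1+r with m≤n⇒m<n∨m≡n j≤1+r
      ... | inj₁ j<1+r = stay j (s≤s⁻¹ j<1+r)
      ... | inj₂ refl = inside

  π : StarV n → Fin n
  π (inj₁ (_ , c)) = c
  π (inj₂ b) = end b

  copy-adj : ∀ {i s s'} → InCopy i s → InCopy i s' → Adj S s s' → Adj G (π s) (π s')
  copy-adj (_ , refl) (_ , refl) (_ , adj , _) = adj

  copy-π-injective : ∀ {i s s'} → InCopy i s → InCopy i s' → π s ≡ π s' → s ≡ s'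
  copy-π-injective (_ , refl) (_ , refl) refl = refl

  module LowerBound (g : ℕ) (girth-le : ∀ (D : Cycle G) → g ≤ cycleLength D) (C : Cycle S) where
    open CycleWalk C

    M : ℕ
    M = m C

    from : ℕ → ℕ → StarV n
    from a j = walk (j + a)

    from-walk : ∀ a → IsWalk S (from a)
    from-walk a j = walk-adj (j + a)

    copy-segment-bound : ∀ a i k → 2 ≤ k → k < L → StaysIn i (from a) k
      → Adj G (π (from a k)) (π (from a 0)) → g ≤ L
    copy-segment-bound a i k 2≤k k<L stay closing =
      bounded (path-cycle (π ∘ from a) k 2≤k steps distinct closing)
      where
        steps : ∀ j → j < k → Adj G (π (from a j)) (π (from a (suc j)))
        steps j j<k = copy-adj (stay j (<⇒≤ j<k)) (stay (suc j) j<k) (from-walk a j)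
        distinct : ∀ {x y} → x ≤ k → y ≤ k → π (from a x) ≡ π (from a y) → x ≡ y
        distinct x≤k y≤k eq = walk-window-injective a (≤-<-trans x≤k k<L) (≤-<-trans y≤k k<L)
          (copy-π-injective (stay _ x≤k) (stay _ y≤k) eq)
        bounded : Σ (Cycle G) (λ D → cycleLength D ≡ suc k) → g ≤ L
        bounded (D , len) = ≤-trans (subst (g ≤_) len (girth-le D)) k<L

    -- Returning to the
    -- same hub would revisit a vertex within one period; otherwise the segment
    -- joins u and v inside the copy avoiding uv, so k ≥ 2 and uv closes it.
    hub-to-hub : ∀ t i k b b' → k < M → walk t ≡ inj₂ b → StaysIn i (from (suc t)) k
      → walk (suc t) ≡ inj₁ (i , end b) → from (suc t) (suc k) ≡ inj₂ b'
      → from (suc t) k ≡ inj₁ (i , end b') → g ≤ L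
    hub-to-hub t i k b b' k<M at-hub stay first exit last with b ≟ᵇ b'
    -- same hub: the segment is the single vertex (i , end b), so hub b recurs after 2 < L steps
    hub-to-hub t i k b b' k<M at-hub _ first exit last | yes refl
      with walk-window-injective (suc t) {0} {k} (s≤s z≤n) (m<n⇒m<1+n k<M) (trans first (sym last))
    ... | refl with walk-window-injective t {0} {2} (s≤s z≤n) (long C) (trans at-hub (sym exit))
    ...   | ()
    hub-to-hub t i k b b' k<M at-hub stay first exit last | no b≢b' with ¬-not (b≢b' ∘ sym)
    -- a single vertex cannot be both u and v
    hub-to-hub t i zero b _ _ _ _ first _ last | no b≢b' | refl =
      ⊥-elim (b≢b' (end-injective (cong π (trans (sym first) last))))
    -- a single step from u to v would use the deleted edge
    hub-to-hub t i (suc zero) b _ _ _ _ first _ last | no _ | refl =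
      ⊥-elim (proj₂ (proj₂ (subst₂ (Adj S) first last (from-walk (suc t) 0))) (ends-edge b))
    hub-to-hub t i k@(suc (suc _)) b _ k<M _ stay first _ last | no _ | refl =
      copy-segment-bound (suc t) i k (s≤s (s≤s z≤n)) (m<n⇒m<1+n k<M) stay
        (subst₂ (Adj G) (cong π (sym last)) (cong π (sym first)) (symm G (ends-adj b)))

    back-at-hub : ∀ t b → walk t ≡ inj₂ b → from (suc t) M ≡ inj₂ b
    back-at-hub t b at-hub = trans (cong walk (+-suc M t)) (trans (walk-periodic t) at-hub)

    bound-via-hub : ∀ t b → walk t ≡ inj₂ b → g ≤ L
    bound-via-hub t b at-hub
      with hub-neighbour b (walk (suc t)) (subst (λ s → Adj S s (walk (suc t))) at-hub (walk-adj t))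
    ... | i , first with leave-copy (from (suc t)) (from-walk (suc t)) (end b , first) M
    ...   | inj₁ stay = ⊥-elim (hub-not-in-copy (subst (InCopy i) (back-at-hub t b at-hub) (stay M ≤-refl)))
    ...   | inj₂ (k , k<M , stay , b' , exit) with stay k ≤-refl
    ...     | c , at-k = hub-to-hub t i k b b' k<M at-hub stay first exit
                           (subst (λ z → from (suc t) k ≡ inj₁ (i , z)) c≡end at-k)
      where
        c≡end : c ≡ end b'
        c≡end = hub-adj b' (subst₂ (Adj S) at-k exit (from-walk (suc t) k))

    lower : g ≤ L
    lower with walk 0 in at-0
    ... | inj₂ b = bound-via-hub 0 b at-0
    ... | inj₁ (i , c) with leave-copy (from 0) (from-walk 0) (c , at-0) M
    ...   | inj₂ (k , _ , _ , b , exit) = bound-via-hub (suc k + 0) b exit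
    ...   | inj₁ stay = copy-segment-bound 0 i M (s≤s⁻¹ (long C)) (n<1+n M) stay closing
      where
        closing : Adj G (π (from 0 M)) (π (from 0 0))
        closing = copy-adj (stay M ≤-refl) (c , at-0) (subst (Adj S (from 0 M)) (walk-periodic 0) (from-walk 0 M))

lemma2 : (g n : ℕ) (G : SimpleGraph (Fin n)) → 3 ≤ g
       → Hamiltonian G → Cubic G → HasGirth G g
       → (u v : Fin n) → Adj G u v
       → (∃ λ (C : Cycle G) → cycleLength C ≡ g × ¬ Traverses C u v)
       → Cubic (Star G u v) × HasGirth (Star G u v) g
lemma2 g n G _ _ cubicG (_ , girth-le) u v uv (C , len , avoids) =
  cubic cubicG , (lifted , trans lifted-len len) , lower-bound
  where
    open StarGraph G u v uv using (cubic; module LowerBound)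
    lifted : Cycle (Star G u v)
    lifted = proj₁ (lift-cycle G u v C avoids)
    lifted-len : cycleLength lifted ≡ cycleLength C
    lifted-len = proj₂ (lift-cycle G u v C avoids)
    lower-bound : ∀ (D : Cycle (Star G u v)) → g ≤ cycleLength D
    lower-bound D = LowerBound.lower g girth-le D
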